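{- Let $T$ be a forest without isolated vertices of order at least $3$, and let $P_T$ be the set of pendant vertices of $T$ that are adjacent to a vertex of degree at least $2$. Then there is a $\delta$-sequence of $T$ of some length $s$ such that $\widetilde z_s(T)\ge |P_T|-|N_T(P_T)|$, and moreover $\widetilde z_i(T)\ge0$ for all $2\le i\le s$.
   Context: A pendant vertex has degree $1$; $N_T(S)$ is the set of vertices adjacent to some vertex of $S$. $+$ is disjoint union, $mK_1$ is $m$ isolated vertices, $K_r$ the complete graph; empty sums are $0$. $\delta$-sequence of a graph $G$ of order $p$ with no isolated vertices and $p-2\ge\delta(G)\ge1$: set $\mathcal G_1=G_1=G$, $m_1=0$, $\delta_1=\delta(G)$. For $i\ge1$, if $\mathcal G_i$ is neither of the form $mK_1$ ($m\ge1$) nor $mK_1+K_r$ ($m\ge0$, $r\ge2$), write $\mathcal G_i=m_iK_1+G_i$ where $m_i\ge0$ is the number of isolated vertices of $\mathcal G_i$ and $G_i$ has no isolated vertices, let $\delta_i=\delta(G_i)$, choose a vertex $u_i$ of degree $\delta_i$ in $G_i$, and obtain $\mathcal G_{i+1}$ from $\mathcal G_i$ by deleting its isolated vertices, $u_i$, and all neighbors of $u_i$. Stop at the first $s$ with $\mathcal G_s=m_sK_1$, $m_s\ge1$ (set $\delta_s=0$) or $\mathcal G_s=m_sK_1+K_r$, $m_s\ge0$, $r\ge2$ (set $\delta_s=r-1$). Let $\widetilde y_j=m_j+1-\delta_j$ and $\widetilde z_i=\sum_{j=2}^i\widetilde y_j$ for $2\le i\le s$. -}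

module Defs where

open import Data.Bool using (Bool; true; false; _∧_; _∨_; not)
open import Data.Nat using (ℕ; zero; suc; _≤_; _≡ᵇ_; _≤ᵇ_; _∸_)
open import Data.Fin using (Fin; _≟_)
open import Data.Fin.Subset using (Subset; ∣_∣; _∈_; ⊤; Nonempty)
open import Data.Vec using (lookup; tabulate)
open import Data.List using (List; []; _∷_; [_]; _++_; length; map; take; drop)
open import Data.List.Relation.Unary.Linked using (Linked)
open import Data.List.Relation.Unary.Unique.Propositional using (Unique)
open import Data.Product using (_×_; Σ; Σ-syntax; ∃; ∃-syntax; _,_)
open import Data.Integer as ℤ using (ℤ; +_)
open import Relation.Binary.PropositionalEquality using (_≡_; _≢_)
open import Relation.Nullary using (¬_)
open import Data.Empty using (⊥)
open import Relation.Nullary.Decidable using (⌊_⌋)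

record Graph (n : ℕ) : Set where
  field
    adj    : Fin n → Fin n → Bool
    sym    : ∀ u v → adj u v ≡ adj v u
    irrefl : ∀ v → adj v v ≡ false
open Graph public

module _ {n : ℕ} (G : Graph n) where

  Adj : Fin n → Fin n → Set
  Adj u v = adj G u v ≡ true

  IsCycle : List (Fin n) → Set
  IsCycle [] = ⊥
  IsCycle (v ∷ rest) =
    3 ≤ length (v ∷ rest) × Unique (v ∷ rest) × Linked Adj (v ∷ rest ++ [ v ])

  IsForest : Set
  IsForest = ∀ vs → ¬ IsCycle vs

  -- Neighbours of v inside the vertex set S (i.e. in the induced subgraph G[S]).
  nbrsIn : Subset n → Fin n → Subset n
  nbrsIn S v = tabulate (λ w → adj G v w ∧ lookup S w)

  degIn : Subset n → Fin n → ℕ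
  degIn S v = ∣ nbrsIn S v ∣

  deg : Fin n → ℕ
  deg = degIn ⊤

  isoSet : Subset n → Subset n
  isoSet S = tabulate (λ v → lookup S v ∧ (degIn S v ≡ᵇ 0))

  nonIsoSet : Subset n → Subset n
  nonIsoSet S = tabulate (λ v → lookup S v ∧ not (degIn S v ≡ᵇ 0))

  -- G[S] is of the form m K₁ with m ≥ 1
  IsEmptyForm : Subset n → Set
  IsEmptyForm S = Nonempty S × (∀ v → v ∈ S → degIn S v ≡ 0)

  -- G[S] is of the form m K₁ + K_r with m ≥ 0, r ≥ 2
  -- (the non-isolated part has at least 2 vertices and is complete)
  IsCliqueForm : Subset n → Set
  IsCliqueForm S = 2 ≤ ∣ nonIsoSet S ∣ ×
    (∀ v w → v ∈ nonIsoSet S → w ∈ nonIsoSet S → v ≢ w → Adj v w)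

  nextSet : Subset n → Fin n → Subset n
  nextSet S u = tabulate (λ v →
    lookup (nonIsoSet S) v ∧ not (⌊ v ≟ u ⌋ ∨ adj G u v))

  -- DeltaSeq S L : L = ((m_i , δ_i) , (m_{i+1} , δ_{i+1}) , … , (m_s , δ_s))
  -- is the tail of a δ-sequence starting from the graph 𝒢_i = G[S].
  data DeltaSeq (S : Subset n) : List (ℕ × ℕ) → Set where
    stopEmpty  : IsEmptyForm S → DeltaSeq S [ (∣ S ∣ , 0) ]
    stopClique : IsCliqueForm S →
                 DeltaSeq S [ (∣ isoSet S ∣ , ∣ nonIsoSet S ∣ ∸ 1) ]
    step       : ∀ {L} (u : Fin n) →
                 ¬ IsEmptyForm S → ¬ IsCliqueForm S →
                 u ∈ nonIsoSet S →
                 (∀ w → w ∈ nonIsoSet S → degIn S u ≤ degIn S w) →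
                 DeltaSeq (nextSet S u) L →
                 DeltaSeq S ((∣ isoSet S ∣ , degIn S u) ∷ L)

  IsDeltaSequence : List (ℕ × ℕ) → Set
  IsDeltaSequence = DeltaSeq ⊤

  PT : Subset n
  PT = tabulate (λ v → (deg v ≡ᵇ 1) ∧
         not (∣ tabulate (λ w → adj G v w ∧ (2 ≤ᵇ deg w)) ∣ ≡ᵇ 0))

  N : Subset n → Subset n
  N S = tabulate (λ w → not (∣ tabulate (λ v → lookup S v ∧ adj G v w) ∣ ≡ᵇ 0))

ytilde : ℕ × ℕ → ℤ
ytilde (m , δ) = (+ m ℤ.+ + 1) ℤ.- + δ

sumℤ : List ℤ → ℤ
sumℤ [] = + 0
sumℤ (x ∷ xs) = x ℤ.+ sumℤ xs

-- z̃_i = Σ_{j=2}^{i} ỹ_j, where L = ((m_1,δ_1), …, (m_s,δ_s))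
ztilde : List (ℕ × ℕ) → ℕ → ℤ
ztilde L i = sumℤ (map ytilde (take (i ∸ 1) (drop 1 L)))

{-# OPTIONS --safe #-}
-- In a forest every induced subgraph with an edge has a vertex of degree 1 (otherwise a longest
-- path would close a cycle), so the δ-sequence can always delete a leaf u together with its unique
-- neighbour w.  Then every δ_j ≤ 1, hence ỹ_j = m_j + 1 - δ_j ≥ m_j ≥ 0.  By induction along the
-- sequence, |S ∩ P_T| ≤ Σ_j m_j + |S ∩ N_T(P_T)| for the δ-sequence of every induced subgraph
-- G[S]: of the vertices that leave S, the isolated ones are paid for by m_j, and at the edge uw
-- the pendant ends are paid for by N_T(P_T), since the other end of an edge with an end in P_T lies
-- in N_T(P_T) and not in P_T.  For S = V(T) there are no isolated vertices, so m_1 = 0.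
module Submission where

open import Defs hiding (sym)

open import Data.Bool using (Bool; true; false; if_then_else_; _∧_; _∨_; not; T)
open import Data.Bool.Properties using (not-¬; ¬-not; T-≡)
open import Data.Empty using (⊥; ⊥-elim)
open import Data.Fin as Fin using (Fin; zero; suc; _≟_)
open import Data.Fin.Properties using (any?; pigeonhole)
open import Data.Fin.Subset using (Subset; ∣_∣; ⊤; _⊂_; _∈_; _∉_; _⊆_; _∩_; _∪_; ⁅_⁆; Nonempty)
open import Data.Fin.Subset.Induction using (Acc; acc; ⊂-wellFounded)
open import Data.Fin.Subset.Properties
  using (_∈?_; ∈⊤; x∈⁅x⁆; x∈⁅y⁆⇒x≡y; x∈p∪q⁺; x∈p∧x≢y⇒x∈p-y; nonempty?; Empty-unique;
         p⊆q⇒∣p∣≤∣q∣; ∣⊥∣≡0; ∣⁅x⁆∣≡1; x∈p⇒∣p-x∣<∣p∣; ∣p∩q∣≤∣p∣; ∩-identityˡ)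
open import Data.Integer as ℤ using (+_; _⊖_)
import Data.Integer.Properties as ℤP
open import Data.List using (List; []; _∷_; [_]; _++_; _∷ʳ_; length; map)
import Data.List as List
open import Data.List.Membership.Propositional.Properties using (∈-lookup; ∈-∃++)
import Data.List.Membership.DecPropositional as DecMembership
open import Data.List.Properties using (length-++; ++-assoc; take-all)
open import Data.List.Relation.Unary.All as All using (All; []; _∷_)
import Data.List.Relation.Unary.All.Properties as All
open import Data.List.Relation.Unary.AllPairs using ([]; _∷_)
open import Data.List.Relation.Unary.Linked using (Linked; []; [-]; _∷_)
open import Data.List.Relation.Unary.Unique.Propositional using (Unique)
open import Data.Nat as ℕ using (ℕ; zero; suc; _+_; _∸_; _≤_; _<_; z≤n; s≤s; _≡ᵇ_)
open import Data.Nat.Properties hiding (_≟_)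
open import Data.Nat.Solver using (module +-*-Solver)
open import Algebra.Properties.CommutativeMonoid.Sum +-0-commutativeMonoid using (sum; ∑-distrib-+)
open import Algebra.Properties.CommutativeSemigroup +-commutativeSemigroup using (x∙yz≈y∙xz)
open import Data.Product using (_×_; Σ-syntax; ∃; _,_; proj₁; proj₂; uncurry)
open import Data.Sum using (_⊎_; inj₁; inj₂)
open import Data.Vec using ([]; _∷_; lookup; tabulate)
open import Data.Vec.Functional using (updateAt)
open import Data.Vec.Functional.Properties using (updateAt-updates; updateAt-minimal)
open import Data.Vec.Properties using (lookup∘tabulate; lookup-zipWith; []=⇒lookup; lookup⇒[]=)
open import Function using (const; _∘_)
open import Function.Bundles using (Equivalence)
open import Relation.Binary.PropositionalEquality hiding ([_])
open import Relation.Nullary using (¬_; ¬?; yes; no; contradiction; _×-dec_)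
open import Relation.Nullary.Decidable using (dec-true; dec-false; isYes≗does; ⌊_⌋)

private
  variable
    n : ℕ

⟦_⟧ : Bool → ℕ
⟦ b ⟧ = if b then 1 else 0

⟦⟧≤1 : ∀ b → ⟦ b ⟧ ≤ 1
⟦⟧≤1 true  = ≤-refl
⟦⟧≤1 false = z≤n

∧≡true⁻ : ∀ {a b} → a ∧ b ≡ true → a ≡ true × b ≡ true
∧≡true⁻ {true} b≡true = refl , b≡true

not-∨≡true⁻ : ∀ {a b} → not (a ∨ b) ≡ true → a ≡ false × b ≡ false
not-∨≡true⁻ {false} {false} _ = refl , refl

≡true⇒T : ∀ {b} → b ≡ true → T b
≡true⇒T = Equivalence.from T-≡

isYes≡false : ∀ {x y : Fin n} → x ≢ y → ⌊ x ≟ y ⌋ ≡ false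
isYes≡false {x = x} {y} x≢y = trans (isYes≗does (x ≟ y)) (dec-false (x ≟ y) x≢y)

0<⇒not≡ᵇ0 : ∀ {m} → 0 < m → not (m ≡ᵇ 0) ≡ true
0<⇒not≡ᵇ0 (s≤s z≤n) = refl

not≡ᵇ0⇒0< : ∀ m → not (m ≡ᵇ 0) ≡ true → 0 < m
not≡ᵇ0⇒0< (suc m) _ = s≤s z≤n

sum-mono : ∀ {f g : Fin n → ℕ} → (∀ i → f i ≤ g i) → sum f ≤ sum g
sum-mono {zero}  f≤g = z≤n
sum-mono {suc n} f≤g = +-mono-≤ (f≤g zero) (sum-mono (f≤g ∘ suc))

sum-updateAt-0 : ∀ (f : Fin n → ℕ) i → sum f ≡ f i + sum (updateAt f i (const 0))
sum-updateAt-0 {suc n} f zero    = refl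
sum-updateAt-0 {suc n} f (suc i) = begin
  f zero + sum (f ∘ suc)                                       ≡⟨ cong (_+_ (f zero)) (sum-updateAt-0 (f ∘ suc) i) ⟩
  f zero + (f (suc i) + sum (updateAt (f ∘ suc) i (const 0))) ≡⟨ x∙yz≈y∙xz (f zero) (f (suc i)) _ ⟩
  f (suc i) + (f zero + sum (updateAt (f ∘ suc) i (const 0))) ∎
  where open ≡-Reasoning

sum-mono-except₂ : ∀ {f g : Fin n → ℕ} {u w} → u ≢ w →
                   (∀ v → v ≢ u → v ≢ w → f v ≤ g v) → f u + f w ≤ g u + g w → sum f ≤ sum g
sum-mono-except₂ {f = f} {g} {u} {w} u≢w f≤g fu+fw≤gu+gw = begin
  sum f                     ≡⟨ split f ⟩
  f u + f w + sum (erase f) ≤⟨ +-mono-≤ fu+fw≤gu+gw (sum-mono erase-mono) ⟩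
  g u + g w + sum (erase g) ≡⟨ split g ⟨
  sum g                     ∎
  where
  open ≤-Reasoning
  erase : (Fin _ → ℕ) → Fin _ → ℕ
  erase h = updateAt (updateAt h u (const 0)) w (const 0)
  split : ∀ h → sum h ≡ h u + h w + sum (erase h)
  split h = begin-equality
    sum h                                            ≡⟨ sum-updateAt-0 h u ⟩
    h u + sum (updateAt h u (const 0))               ≡⟨ cong (_+_ (h u)) (sum-updateAt-0 _ w) ⟩
    h u + (updateAt h u (const 0) w + sum (erase h)) ≡⟨ cong (λ x → h u + (x + sum (erase h)))
                                                              (updateAt-minimal w u h (u≢w ∘ sym)) ⟩
    h u + (h w + sum (erase h))                      ≡⟨ +-assoc (h u) _ _ ⟨
    h u + h w + sum (erase h)                        ∎
  erase-mono : ∀ v → erase f v ≤ erase g v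
  erase-mono v with v ≟ w | v ≟ u
  ... | yes refl | _        = ≤-reflexive (trans (updateAt-updates v _) (sym (updateAt-updates v _)))
  ... | no v≢w   | yes refl = ≤-reflexive (trans (erased f) (sym (erased g)))
    where erased : ∀ h → erase h v ≡ 0
          erased h = trans (updateAt-minimal v w _ v≢w) (updateAt-updates v h)
  ... | no v≢w   | no v≢u   = subst₂ _≤_ (sym (kept f)) (sym (kept g)) (f≤g v v≢u v≢w)
    where kept : ∀ h → erase h v ≡ h v
          kept h = trans (updateAt-minimal v w _ v≢w) (updateAt-minimal v u h v≢u)

χ : Subset n → Fin n → ℕ
χ p v = ⟦ lookup p v ⟧

∣p∣≡sum-χ : ∀ (p : Subset n) → ∣ p ∣ ≡ sum (χ p)
∣p∣≡sum-χ []          = refl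
∣p∣≡sum-χ (true ∷ p)  = cong suc (∣p∣≡sum-χ p)
∣p∣≡sum-χ (false ∷ p) = ∣p∣≡sum-χ p

∉⇒lookup≡false : ∀ {p : Subset n} {v} → v ∉ p → lookup p v ≡ false
∉⇒lookup≡false {p = p} {v} v∉p = ¬-not (v∉p ∘ lookup⇒[]= v p)

χ-∈ : ∀ {p : Subset n} {v} → v ∈ p → χ p v ≡ 1
χ-∈ v∈p = cong ⟦_⟧ ([]=⇒lookup v∈p)

χ-∉ : ∀ {p : Subset n} {v} → v ∉ p → χ p v ≡ 0
χ-∉ v∉p = cong ⟦_⟧ (∉⇒lookup≡false v∉p)

∈-tabulate⁻ : ∀ {f : Fin n → Bool} {v} → v ∈ tabulate f → f v ≡ true
∈-tabulate⁻ {f = f} {v} v∈ = trans (sym (lookup∘tabulate f v)) ([]=⇒lookup v∈)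

∈-tabulate⁺ : ∀ {f : Fin n → Bool} {v} → f v ≡ true → v ∈ tabulate f
∈-tabulate⁺ {f = f} {v} fv = lookup⇒[]= v _ (trans (lookup∘tabulate f v) fv)

∣p∪q∣≤∣p∣+∣q∣ : ∀ (p q : Subset n) → ∣ p ∪ q ∣ ≤ ∣ p ∣ + ∣ q ∣
∣p∪q∣≤∣p∣+∣q∣ []          []          = z≤n
∣p∪q∣≤∣p∣+∣q∣ (true ∷ p)  (true ∷ q)  = s≤s (≤-trans (∣p∪q∣≤∣p∣+∣q∣ p q) (+-monoʳ-≤ ∣ p ∣ (n≤1+n ∣ q ∣)))
∣p∪q∣≤∣p∣+∣q∣ (true ∷ p)  (false ∷ q) = s≤s (∣p∪q∣≤∣p∣+∣q∣ p q)
∣p∪q∣≤∣p∣+∣q∣ (false ∷ p) (true ∷ q)  = ≤-trans (s≤s (∣p∪q∣≤∣p∣+∣q∣ p q)) (≤-reflexive (sym (+-suc ∣ p ∣ ∣ q ∣)))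
∣p∪q∣≤∣p∣+∣q∣ (false ∷ p) (false ∷ q) = ∣p∪q∣≤∣p∣+∣q∣ p q

x∈p⇒0<∣p∣ : ∀ {p : Subset n} {x} → x ∈ p → 0 < ∣ p ∣
x∈p⇒0<∣p∣ {p = p} {x} x∈p = subst (_≤ ∣ p ∣) (∣⁅x⁆∣≡1 x) (p⊆q⇒∣p∣≤∣q∣ ⁅x⁆⊆p)
  where ⁅x⁆⊆p : ⁅ x ⁆ ⊆ p
        ⁅x⁆⊆p y∈⁅x⁆ = subst (_∈ p) (sym (x∈⁅y⁆⇒x≡y x y∈⁅x⁆)) x∈p

x∈p∧y∈p∧x≢y⇒2≤∣p∣ : ∀ {p : Subset n} {x y} → x ∈ p → y ∈ p → x ≢ y → 2 ≤ ∣ p ∣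
x∈p∧y∈p∧x≢y⇒2≤∣p∣ x∈p y∈p x≢y =
  ≤-trans (s≤s (x∈p⇒0<∣p∣ (x∈p∧x≢y⇒x∈p-y y∈p (x≢y ∘ sym)))) (x∈p⇒∣p-x∣<∣p∣ x∈p)

∣p∣≤1⇒x≡y : ∀ {p : Subset n} {x y} → ∣ p ∣ ≤ 1 → x ∈ p → y ∈ p → x ≡ y
∣p∣≤1⇒x≡y {x = x} {y} ∣p∣≤1 x∈p y∈p with x ≟ y
... | yes x≡y = x≡y
... | no  x≢y = contradiction (x∈p∧y∈p∧x≢y⇒2≤∣p∣ x∈p y∈p x≢y) (<⇒≱ (s≤s ∣p∣≤1))

0<∣p∣⇒Nonempty : ∀ {p : Subset n} → 0 < ∣ p ∣ → Nonempty p
0<∣p∣⇒Nonempty {n} {p} 0<∣p∣ with nonempty? p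
... | yes nonempty = nonempty
... | no  empty    = contradiction (trans (cong ∣_∣ (Empty-unique empty)) (∣⊥∣≡0 n)) (≢-sym (<⇒≢ 0<∣p∣))

2≤∣p∣⇒∃≢ : ∀ {p : Subset n} → 2 ≤ ∣ p ∣ → ∀ z → ∃ λ y → y ∈ p × y ≢ z
2≤∣p∣⇒∃≢ {p = p} 2≤∣p∣ z with any? (λ y → y ∈? p ×-dec ¬? (y ≟ z))
... | yes witness = witness
... | no  none    = contradiction (≤-trans 2≤∣p∣ ∣p∣≤1) (<-irrefl refl)
  where p⊆⁅z⁆ : p ⊆ ⁅ z ⁆
        p⊆⁅z⁆ {y} y∈p with y ≟ z
        ... | yes refl = x∈⁅x⁆ y
        ... | no  y≢z  = contradiction (y , y∈p , y≢z) none
        ∣p∣≤1 : ∣ p ∣ ≤ 1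
        ∣p∣≤1 = subst (∣ p ∣ ≤_) (∣⁅x⁆∣≡1 z) (p⊆q⇒∣p∣≤∣q∣ p⊆⁅z⁆)

∣p∣≤2 : ∀ {p : Subset n} {x y} → (∀ {v} → v ∈ p → v ≡ x ⊎ v ≡ y) → ∣ p ∣ ≤ 2
∣p∣≤2 {p = p} {x} {y} p⊆xy = begin
  ∣ p ∣                  ≤⟨ p⊆q⇒∣p∣≤∣q∣ p⊆⁅x⁆∪⁅y⁆ ⟩
  ∣ ⁅ x ⁆ ∪ ⁅ y ⁆ ∣      ≤⟨ ∣p∪q∣≤∣p∣+∣q∣ ⁅ x ⁆ ⁅ y ⁆ ⟩
  ∣ ⁅ x ⁆ ∣ + ∣ ⁅ y ⁆ ∣  ≡⟨ cong₂ _+_ (∣⁅x⁆∣≡1 x) (∣⁅x⁆∣≡1 y) ⟩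
  2                      ∎
  where
  open ≤-Reasoning
  p⊆⁅x⁆∪⁅y⁆ : p ⊆ ⁅ x ⁆ ∪ ⁅ y ⁆
  p⊆⁅x⁆∪⁅y⁆ v∈p with p⊆xy v∈p
  ... | inj₁ refl = x∈p∪q⁺ (inj₁ (x∈⁅x⁆ x))
  ... | inj₂ refl = x∈p∪q⁺ (inj₂ (x∈⁅x⁆ y))

Unique⇒length≤ : ∀ {xs : List (Fin n)} → Unique xs → length xs ≤ n
Unique⇒length≤ {n} {xs} unique with length xs ≤? n
... | yes ≤n = ≤n
... | no  ≰n with i , j , i<j , eq ← pigeonhole (≰⇒> ≰n) (List.lookup xs) =
  contradiction eq (lookup-distinct unique i<j)
  where
  lookup-distinct : ∀ {ys : List (Fin n)} → Unique ys → ∀ {i j} → i Fin.< j →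
                    List.lookup ys i ≢ List.lookup ys j
  lookup-distinct (y∉ys ∷ _)      {zero}  {suc j} _         = All.lookup y∉ys (∈-lookup j)
  lookup-distinct (_    ∷ unique) {suc i} {suc j} (s≤s i<j) = lookup-distinct unique i<j

Unique-++⁻ˡ : ∀ {A : Set} (xs : List A) {ys} → Unique (xs ++ ys) → Unique xs
Unique-++⁻ˡ []       _              = []
Unique-++⁻ˡ (x ∷ xs) (x∉ ∷ unique) = All.++⁻ˡ xs x∉ ∷ Unique-++⁻ˡ xs unique

module _ {A : Set} {R : A → A → Set} where

  Linked-++⁻ˡ : ∀ (xs : List A) {ys} → Linked R (xs ++ ys) → Linked R xs
  Linked-++⁻ˡ []           _          = []
  Linked-++⁻ˡ (x ∷ [])     _          = [-]
  Linked-++⁻ˡ (x ∷ y ∷ xs) (r ∷ rxs) = r ∷ Linked-++⁻ˡ (y ∷ xs) rxs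

  Linked-∷ʳ : ∀ (xs : List A) {y z} → Linked R (xs ∷ʳ y) → R y z → Linked R (xs ∷ʳ y ∷ʳ z)
  Linked-∷ʳ []           _          ryz = ryz ∷ [-]
  Linked-∷ʳ (x ∷ [])     (r ∷ _)    ryz = r ∷ ryz ∷ [-]
  Linked-∷ʳ (x ∷ y ∷ xs) (r ∷ rxs) ryz = r ∷ Linked-∷ʳ (y ∷ xs) rxs ryz

module _ (G : Graph n) where

  Adj-sym : ∀ {u v} → Adj G u v → Adj G v u
  Adj-sym {u} {v} u~v = trans (sym (Graph.sym G u v)) u~v

  Adj⇒≢ : ∀ {u v} → Adj G u v → u ≢ v
  Adj⇒≢ {u} u~u refl with () ← trans (sym u~u) (irrefl G u)

  closedPath⇒IsCycle : ∀ {x y z} zs → Unique (x ∷ y ∷ zs ∷ʳ z) → Linked (Adj G) (x ∷ y ∷ zs ∷ʳ z) →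
                       Adj G z x → IsCycle G (x ∷ y ∷ zs ∷ʳ z)
  closedPath⇒IsCycle {x} {y} zs unique path z~x =
    s≤s (s≤s (subst (1 ≤_) (sym (length-++ zs)) (m≤n+m 1 (length zs)))) ,
    unique ,
    Linked-∷ʳ (x ∷ y ∷ zs) path z~x

  module _ (S : Subset n) where

    ∈nbrsIn⁺ : ∀ {v w} → Adj G v w → w ∈ S → w ∈ nbrsIn G S v
    ∈nbrsIn⁺ v~w w∈S = ∈-tabulate⁺ (cong₂ _∧_ v~w ([]=⇒lookup w∈S))

    ∈nbrsIn⁻ : ∀ {v w} → w ∈ nbrsIn G S v → Adj G v w × w ∈ S
    ∈nbrsIn⁻ {v} {w} w∈nbrs with v~w , Sw ← ∧≡true⁻ (∈-tabulate⁻ w∈nbrs) = v~w , lookup⇒[]= w S Sw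

    Adj⇒0<degIn : ∀ {v w} → Adj G v w → w ∈ S → 0 < degIn G S v
    Adj⇒0<degIn v~w w∈S = x∈p⇒0<∣p∣ (∈nbrsIn⁺ v~w w∈S)

    degIn≡1⇒x≡y : ∀ {v x y} → degIn G S v ≡ 1 → Adj G v x → x ∈ S → Adj G v y → y ∈ S → x ≡ y
    degIn≡1⇒x≡y deg≡1 v~x x∈S v~y y∈S = ∣p∣≤1⇒x≡y (≤-reflexive deg≡1) (∈nbrsIn⁺ v~x x∈S) (∈nbrsIn⁺ v~y y∈S)

    ∈nonIsoSet⁺ : ∀ {v} → v ∈ S → 0 < degIn G S v → v ∈ nonIsoSet G S
    ∈nonIsoSet⁺ v∈S 0<deg = ∈-tabulate⁺ (cong₂ _∧_ ([]=⇒lookup v∈S) (0<⇒not≡ᵇ0 0<deg))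

    ∈nonIsoSet⁻ : ∀ {v} → v ∈ nonIsoSet G S → v ∈ S × 0 < degIn G S v
    ∈nonIsoSet⁻ {v} v∈nonIso with Sv , deg≢0 ← ∧≡true⁻ (∈-tabulate⁻ v∈nonIso) =
      lookup⇒[]= v S Sv , not≡ᵇ0⇒0< _ deg≢0

    ∈nextSet⁺ : ∀ {u v} → v ∈ nonIsoSet G S → v ≢ u → adj G u v ≡ false → v ∈ nextSet G S u
    ∈nextSet⁺ v∈nonIso v≢u ¬u~v = ∈-tabulate⁺
      (cong₂ _∧_ ([]=⇒lookup v∈nonIso) (cong₂ (λ a b → not (a ∨ b)) (isYes≡false v≢u) ¬u~v))

    ∈nextSet⁻ : ∀ {u v} → v ∈ nextSet G S u → v ∈ nonIsoSet G S × v ≢ u × ¬ Adj G u v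
    ∈nextSet⁻ {u} {v} v∈S′ with nonIso , fresh ← ∧≡true⁻ (∈-tabulate⁻ v∈S′)
                           with v≟u-false , u≁v ← not-∨≡true⁻ fresh =
      lookup⇒[]= v _ nonIso ,
      (λ v≡u → not-¬ (trans (isYes≗does (v ≟ u)) (dec-true (v ≟ u) v≡u)) v≟u-false) ,
      (λ u~v → not-¬ u~v u≁v)

    nextSet⊂ : ∀ {u} → u ∈ S → nextSet G S u ⊂ S
    nextSet⊂ {u} u∈S = (λ v∈S′ → proj₁ (∈nonIsoSet⁻ (proj₁ (∈nextSet⁻ v∈S′)))) ,
                       u , u∈S , λ u∈S′ → proj₁ (proj₂ (∈nextSet⁻ u∈S′)) refl

  module _ (noIsolated : ∀ v → 1 ≤ deg G v) where

    ¬IsEmptyForm⊤ : Fin n → ¬ IsEmptyForm G ⊤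
    ¬IsEmptyForm⊤ v (_ , deg≡0) = <⇒≢ (noIsolated v) (sym (deg≡0 v ∈⊤))

    ∣isoSet⊤∣≡0 : ∣ isoSet G ⊤ ∣ ≡ 0
    ∣isoSet⊤∣≡0 = trans (cong ∣_∣ (Empty-unique noIsolatedVertex)) (∣⊥∣≡0 n)
      where noIsolatedVertex : ¬ Nonempty (isoSet G ⊤)
            noIsolatedVertex (v , v∈iso) with _ , deg≡ᵇ0 ← ∧≡true⁻ (∈-tabulate⁻ v∈iso) =
              <⇒≢ (noIsolated v) (sym (≡ᵇ⇒≡ _ 0 (≡true⇒T deg≡ᵇ0)))

  deltaSeq-head : ∀ {S m δ L} → DeltaSeq G S ((m , δ) ∷ L) → ¬ IsEmptyForm G S → m ≡ ∣ isoSet G S ∣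
  deltaSeq-head (stopEmpty empty)  ¬empty = contradiction empty ¬empty
  deltaSeq-head (stopClique _)     _      = refl
  deltaSeq-head (step _ _ _ _ _ _) _      = refl

module _ {G : Graph n} (forest : IsForest G) where

  open DecMembership (Fin._≟_ {n}) using () renaming (_∈_ to _∈ₗ_; _∈?_ to _∈ₗ?_)

  private
    previous : Fin n → List (Fin n) → Fin n
    previous x []      = x
    previous x (y ∷ _) = y

  -- Paths are listed from their current endpoint x backwards.
  revisit⇒cycle : ∀ {x y} rest → y ∈ₗ x ∷ rest → Unique (x ∷ rest) → Linked (Adj G) (x ∷ rest) →
                  Adj G x y → y ≢ previous x rest → ⊥
  revisit⇒cycle {x} {y} rest y∈path unique path x~y y≢prev with ∈-∃++ y∈path
  ... | []         , _  , refl = Adj⇒≢ G x~y refl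
  ... | _ ∷ []     , _  , refl = y≢prev refl
  ... | _ ∷ b ∷ bs , zs , refl = forest (x ∷ b ∷ bs ∷ʳ y) (closedPath⇒IsCycle G bs
    (Unique-++⁻ˡ (x ∷ b ∷ bs ∷ʳ y) (subst Unique (sym (++-assoc (x ∷ b ∷ bs) [ y ] zs)) unique))
    (Linked-++⁻ˡ (x ∷ b ∷ bs ∷ʳ y) (subst (Linked (Adj G)) (sym (++-assoc (x ∷ b ∷ bs) [ y ] zs)) path))
    (Adj-sym G x~y))

  module _ (S : Subset n) (branching : ∀ {u} → u ∈ S → 0 < degIn G S u → 2 ≤ degIn G S u) where

    ¬path : ∀ fuel x rest → n < length (x ∷ rest) + fuel → Unique (x ∷ rest) →
            Linked (Adj G) (x ∷ rest) → x ∈ S → 0 < degIn G S x → ⊥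
    ¬path zero x rest n<len unique _ _ _ =
      <⇒≱ n<len (subst (_≤ n) (sym (+-identityʳ _)) (Unique⇒length≤ unique))
    ¬path (suc fuel) x rest n<len unique path x∈S 0<deg
      with y , y∈nbrs , y≢prev ← 2≤∣p∣⇒∃≢ (branching x∈S 0<deg) (previous x rest)
      with x~y , y∈S ← ∈nbrsIn⁻ G S y∈nbrs
      with y ∈ₗ? (x ∷ rest)
    ... | yes y∈path = revisit⇒cycle rest y∈path unique path x~y y≢prev
    ... | no  y∉path =
      ¬path fuel y (x ∷ rest) (subst (n <_) (+-suc _ fuel) n<len) (All.¬Any⇒All¬ _ y∉path ∷ unique)
            (Adj-sym G x~y ∷ path) y∈S (Adj⇒0<degIn G S (Adj-sym G x~y) x∈S)

  ∃leaf : ∀ S {v} → v ∈ S → 0 < degIn G S v → ∃ λ u → u ∈ S × degIn G S u ≡ 1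
  ∃leaf S {v} v∈S 0<deg with any? (λ u → u ∈? S ×-dec degIn G S u ℕ.≟ 1)
  ... | yes leaf = leaf
  ... | no  ¬leaf = ⊥-elim (¬path S branching n v [] ≤-refl ([] ∷ []) [-] v∈S 0<deg)
    where
    branching : ∀ {u} → u ∈ S → 0 < degIn G S u → 2 ≤ degIn G S u
    branching {u} u∈S 0<deg = ≤∧≢⇒< 0<deg (λ 1≡deg → ¬leaf (u , u∈S , sym 1≡deg))

module _ (G : Graph n) where

  ∈PT⁻ : ∀ {a} → a ∈ PT G → deg G a ≡ 1 × ∃ λ b → Adj G a b × 2 ≤ deg G b
  ∈PT⁻ a∈P with deg≡1 , hasHub ← ∧≡true⁻ (∈-tabulate⁻ a∈P)
           with b , b∈hubs ← 0<∣p∣⇒Nonempty (not≡ᵇ0⇒0< _ hasHub)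
           with a~b , 2≤deg ← ∧≡true⁻ (∈-tabulate⁻ b∈hubs) =
    ≡ᵇ⇒≡ _ 1 (≡true⇒T deg≡1) , b , a~b , ≤ᵇ⇒≤ 2 _ (≡true⇒T 2≤deg)

  ∈N⁺ : ∀ {X a b} → a ∈ X → Adj G a b → b ∈ N G X
  ∈N⁺ {X} {a} {b} a∈X a~b = ∈-tabulate⁺ (0<⇒not≡ᵇ0 (x∈p⇒0<∣p∣ a∈X∩N[b]))
    where a∈X∩N[b] : a ∈ tabulate (λ v → lookup X v ∧ adj G v b)
          a∈X∩N[b] = ∈-tabulate⁺ (cong₂ _∧_ ([]=⇒lookup a∈X) a~b)

  PT-Adj⇒∉PT : ∀ {a b} → a ∈ PT G → Adj G a b → b ∉ PT G
  PT-Adj⇒∉PT a∈P a~b b∈P with deg≡1 , c , a~c , 2≤deg ← ∈PT⁻ a∈P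
                         with refl ← degIn≡1⇒x≡y G ⊤ deg≡1 a~b ∈⊤ a~c ∈⊤ =
    <-irrefl refl (≤-trans 2≤deg (≤-reflexive (proj₁ (∈PT⁻ b∈P))))

  pendantEdge : ∀ {a b} → Adj G a b → χ (PT G) a + χ (PT G) b ≤ χ (N G (PT G)) a + χ (N G (PT G)) b
  pendantEdge {a} {b} a~b with a ∈? PT G | b ∈? PT G
  ... | yes a∈P | _
    rewrite χ-∈ a∈P | χ-∉ (PT-Adj⇒∉PT a∈P a~b) | χ-∈ (∈N⁺ a∈P a~b) = m≤n+m 1 _
  ... | no a∉P | yes b∈P
    rewrite χ-∉ a∉P | χ-∈ b∈P | χ-∈ (∈N⁺ b∈P (Adj-sym G a~b)) = s≤s z≤n
  ... | no a∉P | no b∉P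
    rewrite χ-∉ a∉P | χ-∉ b∉P = z≤n

-- The contributions of a vertex v ∉ {u, w} to both sides of the leaf-removal count: s, z, a, p, q
-- say whether v ∈ S, v is isolated in G[S], u ~ v, v ∈ P_T, v ∈ N_T(P_T); s′ whether v survives.
leafRemoval-pointwise : ∀ s z a p q → (s ≡ true → a ≡ false) →
  let s′ = (s ∧ not z) ∧ not (false ∨ a) in
  ⟦ s ∧ p ⟧ + ⟦ s′ ∧ q ⟧ ≤ (⟦ s ∧ z ⟧ + ⟦ s′ ∧ p ⟧) + ⟦ s ∧ q ⟧
leafRemoval-pointwise false _     _     _ _ _    = z≤n
leafRemoval-pointwise true  _     true  _ _ s⇒≁ with () ← s⇒≁ refl
leafRemoval-pointwise true  true  false p q _    =
  ≤-trans (≤-reflexive (+-identityʳ ⟦ p ⟧)) (≤-trans (⟦⟧≤1 p) (m≤m+n 1 ⟦ q ⟧))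
leafRemoval-pointwise true  false false p q _    = ≤-refl

module LeafRemoval (T : Graph n) {S : Subset n} {u w : Fin n}
  (u∈S : u ∈ S) (u~w : Adj T u w) (w∈S : w ∈ S) (deg[u]≡1 : degIn T S u ≡ 1) where

  private
    P  = PT T
    NP = N T P
    S′ = nextSet T S u
    I  = isoSet T S

  only-neighbour : ∀ {v} → Adj T u v → v ∈ S → v ≡ w
  only-neighbour u~v v∈S = degIn≡1⇒x≡y T S deg[u]≡1 u~v v∈S u~w w∈S

  u∉S′ : u ∉ S′
  u∉S′ u∈S′ = proj₁ (proj₂ (∈nextSet⁻ T S u∈S′)) refl

  w∉S′ : w ∉ S′
  w∉S′ w∈S′ = proj₂ (proj₂ (∈nextSet⁻ T S w∈S′)) u~w

  nonIso∖S′⊆uw : ∀ {v} → v ∈ nonIsoSet T S → v ∉ S′ → v ≡ u ⊎ v ≡ w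
  nonIso∖S′⊆uw {v} v∈nonIso v∉S′ with v ≟ u
  ... | yes v≡u = inj₁ v≡u
  ... | no  v≢u with adj T u v in u~v
  ...   | true  = inj₂ (only-neighbour u~v (proj₁ (∈nonIsoSet⁻ T S v∈nonIso)))
  ...   | false = contradiction (∈nextSet⁺ T S v∈nonIso v≢u u~v) v∉S′

  private
    lookup-nextSet : ∀ v → lookup S′ v ≡ (lookup S v ∧ not (degIn T S v ≡ᵇ 0)) ∧ not (⌊ v ≟ u ⌋ ∨ adj T u v)
    lookup-nextSet v = trans (lookup∘tabulate _ v) (cong (_∧ _) (lookup∘tabulate _ v))

    elsewhere : ∀ v → v ≢ u → v ≢ w → χ (S ∩ P) v + χ (S′ ∩ NP) v ≤ (χ I v + χ (S′ ∩ P) v) + χ (S ∩ NP) v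
    elsewhere v v≢u v≢w
      rewrite lookup-zipWith _∧_ v S P | lookup-zipWith _∧_ v S′ NP | lookup-zipWith _∧_ v S′ P
            | lookup-zipWith _∧_ v S NP | lookup∘tabulate (λ x → lookup S x ∧ (degIn T S x ≡ᵇ 0)) v
            | lookup-nextSet v | isYes≡false v≢u
      = leafRemoval-pointwise _ _ _ _ _ λ v∈S → ¬-not λ u~v → v≢w (only-neighbour u~v (lookup⇒[]= v S v∈S))

    at-removed : ∀ {v} → v ∈ S → v ∉ S′ → χ (S ∩ P) v + χ (S′ ∩ NP) v ≡ χ P v
    at-removed {v} v∈S v∉S′
      rewrite lookup-zipWith _∧_ v S P | lookup-zipWith _∧_ v S′ NP | []=⇒lookup v∈S | ∉⇒lookup≡false v∉S′
      = +-identityʳ _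

    at-kept : ∀ {v} → v ∈ S → χ NP v ≤ (χ I v + χ (S′ ∩ P) v) + χ (S ∩ NP) v
    at-kept {v} v∈S rewrite lookup-zipWith _∧_ v S NP | []=⇒lookup v∈S = m≤n+m _ _

    at-edge : (χ (S ∩ P) u + χ (S′ ∩ NP) u) + (χ (S ∩ P) w + χ (S′ ∩ NP) w) ≤
              ((χ I u + χ (S′ ∩ P) u) + χ (S ∩ NP) u) + ((χ I w + χ (S′ ∩ P) w) + χ (S ∩ NP) w)
    at-edge = begin
      (χ (S ∩ P) u + χ (S′ ∩ NP) u) + (χ (S ∩ P) w + χ (S′ ∩ NP) w)
        ≡⟨ cong₂ _+_ (at-removed u∈S u∉S′) (at-removed w∈S w∉S′) ⟩
      χ P u + χ P w
        ≤⟨ pendantEdge T u~w ⟩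
      χ NP u + χ NP w
        ≤⟨ +-mono-≤ (at-kept u∈S) (at-kept w∈S) ⟩
      ((χ I u + χ (S′ ∩ P) u) + χ (S ∩ NP) u) + ((χ I w + χ (S′ ∩ P) w) + χ (S ∩ NP) w) ∎
      where open ≤-Reasoning

  count-bound : ∣ S ∩ P ∣ + ∣ S′ ∩ NP ∣ ≤ (∣ I ∣ + ∣ S′ ∩ P ∣) + ∣ S ∩ NP ∣
  count-bound = begin
    ∣ S ∩ P ∣ + ∣ S′ ∩ NP ∣
      ≡⟨ cong₂ _+_ (∣p∣≡sum-χ (S ∩ P)) (∣p∣≡sum-χ (S′ ∩ NP)) ⟩
    sum (χ (S ∩ P)) + sum (χ (S′ ∩ NP))
      ≡⟨ ∑-distrib-+ (χ (S ∩ P)) (χ (S′ ∩ NP)) ⟨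
    sum (λ v → χ (S ∩ P) v + χ (S′ ∩ NP) v)
      ≤⟨ sum-mono-except₂ (Adj⇒≢ T u~w) elsewhere at-edge ⟩
    sum (λ v → (χ I v + χ (S′ ∩ P) v) + χ (S ∩ NP) v)
      ≡⟨ ∑-distrib-+ (λ v → χ I v + χ (S′ ∩ P) v) (χ (S ∩ NP)) ⟩
    sum (λ v → χ I v + χ (S′ ∩ P) v) + sum (χ (S ∩ NP))
      ≡⟨ cong (_+ sum (χ (S ∩ NP))) (∑-distrib-+ (χ I) (χ (S′ ∩ P))) ⟩
    (sum (χ I) + sum (χ (S′ ∩ P))) + sum (χ (S ∩ NP))
      ≡⟨ cong₂ _+_ (cong₂ _+_ (∣p∣≡sum-χ I) (∣p∣≡sum-χ (S′ ∩ P))) (∣p∣≡sum-χ (S ∩ NP)) ⟨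
    (∣ I ∣ + ∣ S′ ∩ P ∣) + ∣ S ∩ NP ∣
      ∎
    where open ≤-Reasoning

Σm : List (ℕ × ℕ) → ℕ
Σm []            = 0
Σm ((m , _) ∷ L) = m + Σm L

+-rebalance : ∀ a b c d i t → a + d ≤ (i + c) + b → c ≤ t + d → a ≤ (i + t) + b
+-rebalance a b c d i t a+d≤i+c+b c≤t+d = +-cancelʳ-≤ d a ((i + t) + b) (begin
  a + d             ≤⟨ a+d≤i+c+b ⟩
  (i + c) + b       ≤⟨ +-monoˡ-≤ b (+-monoʳ-≤ i c≤t+d) ⟩
  (i + (t + d)) + b ≡⟨ solve 4 (λ b d i t → (i :+ (t :+ d)) :+ b := ((i :+ t) :+ b) :+ d) refl b d i t ⟩
  ((i + t) + b) + d ∎)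
  where open ≤-Reasoning
        open +-*-Solver

module Construction (T : Graph n) (forest : IsForest T) where

  private
    P  = PT T
    NP = N T P

  record GoodDeltaSeq (S : Subset n) : Set where
    field
      entries : List (ℕ × ℕ)
      valid   : DeltaSeq T S entries
      δ≤1     : All (λ e → proj₂ e ≤ 1) entries
      bound   : ∣ S ∩ P ∣ ≤ Σm entries + ∣ S ∩ NP ∣

  emptyStop : ∀ {S} → Nonempty S → ¬ Nonempty (nonIsoSet T S) → GoodDeltaSeq S
  emptyStop {S} nonempty noEdge = record
    { entries = [ (∣ S ∣ , 0) ]
    ; valid   = stopEmpty (nonempty , deg≡0)
    ; δ≤1     = z≤n ∷ []
    ; bound   = ≤-trans (∣p∩q∣≤∣p∣ S P) (≤-trans (m≤m+n ∣ S ∣ 0) (m≤m+n _ _))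
    }
    where deg≡0 : ∀ v → v ∈ S → degIn T S v ≡ 0
          deg≡0 v v∈S = n≤0⇒n≡0 (≮⇒≥ λ 0<deg → noEdge (v , ∈nonIsoSet⁺ T S v∈S 0<deg))

  module _ {S : Subset n} {u w : Fin n} (u∈S : u ∈ S) (u~w : Adj T u w) (w∈S : w ∈ S)
           (deg[u]≡1 : degIn T S u ≡ 1) where

    open LeafRemoval T u∈S u~w w∈S deg[u]≡1

    private
      S′ = nextSet T S u
      I  = isoSet T S

      u∈nonIso : u ∈ nonIsoSet T S
      u∈nonIso = ∈nonIsoSet⁺ T S u∈S (≤-reflexive (sym deg[u]≡1))

    leafStep : Nonempty S′ → GoodDeltaSeq S′ → GoodDeltaSeq S
    leafStep (y , y∈S′) rest = record
      { entries = (∣ I ∣ , degIn T S u) ∷ entries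
      ; valid   = step u ¬empty ¬clique u∈nonIso minimal valid
      ; δ≤1     = ≤-reflexive deg[u]≡1 ∷ δ≤1
      ; bound   = +-rebalance (∣ S ∩ P ∣) (∣ S ∩ NP ∣) (∣ S′ ∩ P ∣) (∣ S′ ∩ NP ∣) (∣ I ∣) (Σm entries)
                              count-bound bound
      }
      where
      open GoodDeltaSeq rest
      ¬empty : ¬ IsEmptyForm T S
      ¬empty (_ , deg≡0) = 1+n≢0 (trans (sym deg[u]≡1) (deg≡0 u u∈S))
      ¬clique : ¬ IsCliqueForm T S
      ¬clique (_ , complete) with y∈nonIso , y≢u , u≁y ← ∈nextSet⁻ T S y∈S′ =
        u≁y (complete u y u∈nonIso y∈nonIso (y≢u ∘ sym))
      minimal : ∀ v → v ∈ nonIsoSet T S → degIn T S u ≤ degIn T S v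
      minimal v v∈nonIso = subst (_≤ degIn T S v) (sym deg[u]≡1) (proj₂ (∈nonIsoSet⁻ T S v∈nonIso))

    cliqueStop : ¬ Nonempty S′ → GoodDeltaSeq S
    cliqueStop S′-empty = record
      { entries = [ (∣ I ∣ , ∣ nonIsoSet T S ∣ ∸ 1) ]
      ; valid   = stopClique (x∈p∧y∈p∧x≢y⇒2≤∣p∣ u∈nonIso w∈nonIso (Adj⇒≢ T u~w) , complete)
      ; δ≤1     = ∸-monoˡ-≤ 1 (∣p∣≤2 only-u-w) ∷ []
      ; bound   = +-rebalance (∣ S ∩ P ∣) (∣ S ∩ NP ∣) (∣ S′ ∩ P ∣) (∣ S′ ∩ NP ∣) (∣ I ∣) 0
                              count-bound ∣S′∩P∣≤0+∣S′∩NP∣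
      }
      where
      w∈nonIso : w ∈ nonIsoSet T S
      w∈nonIso = ∈nonIsoSet⁺ T S w∈S (Adj⇒0<degIn T S (Adj-sym T u~w) u∈S)
      only-u-w : ∀ {v} → v ∈ nonIsoSet T S → v ≡ u ⊎ v ≡ w
      only-u-w v∈nonIso = nonIso∖S′⊆uw v∈nonIso λ v∈S′ → S′-empty (_ , v∈S′)
      complete : ∀ a b → a ∈ nonIsoSet T S → b ∈ nonIsoSet T S → a ≢ b → Adj T a b
      complete a b a∈nonIso b∈nonIso a≢b with only-u-w a∈nonIso | only-u-w b∈nonIso
      ... | inj₁ refl | inj₁ refl = contradiction refl a≢b
      ... | inj₁ refl | inj₂ refl = u~w
      ... | inj₂ refl | inj₁ refl = Adj-sym T u~w
      ... | inj₂ refl | inj₂ refl = contradiction refl a≢b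
      ∣S′∩P∣≤0+∣S′∩NP∣ : ∣ S′ ∩ P ∣ ≤ 0 + ∣ S′ ∩ NP ∣
      ∣S′∩P∣≤0+∣S′∩NP∣ = ≤-trans (∣p∩q∣≤∣p∣ S′ P)
        (≤-trans (≤-reflexive (trans (cong ∣_∣ (Empty-unique S′-empty)) (∣⊥∣≡0 n))) z≤n)

  goodDeltaSeq : ∀ S → Acc _⊂_ S → Nonempty S → GoodDeltaSeq S
  goodDeltaSeq S (acc rec) nonempty with nonempty? (nonIsoSet T S)
  ... | no  noEdge = emptyStop nonempty noEdge
  ... | yes (v , v∈nonIso)
    with u , u∈S , deg≡1 ← uncurry (∃leaf forest S) (∈nonIsoSet⁻ T S v∈nonIso)
    with w , w∈nbrs ← 0<∣p∣⇒Nonempty (≤-reflexive (sym deg≡1))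
    with u~w , w∈S ← ∈nbrsIn⁻ T S w∈nbrs
    with nonempty? (nextSet T S u)
  ... | yes nonempty′ = leafStep u∈S u~w w∈S deg≡1 nonempty′
                          (goodDeltaSeq _ (rec (nextSet⊂ T S u∈S)) nonempty′)
  ... | no  empty′    = cliqueStop u∈S u~w w∈S deg≡1 empty′

+m≤ytilde : ∀ m δ → δ ≤ 1 → + m ℤ.≤ ytilde (m , δ)
+m≤ytilde m δ δ≤1 = begin
  + m            ≡⟨ cong +_ (m+n∸n≡m m 1) ⟨
  + (m + 1 ∸ 1)  ≤⟨ ℤ.+≤+ (∸-monoʳ-≤ (m + 1) δ≤1) ⟩
  + (m + 1 ∸ δ)  ≡⟨ ℤP.≤-⊖ (≤-trans δ≤1 (m≤n+m 1 m)) ⟨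
  (m + 1) ⊖ δ    ≡⟨ ℤP.[+m]-[+n]≡m⊖n (m + 1) δ ⟨
  ytilde (m , δ) ∎
  where open ℤP.≤-Reasoning

+Σm≤sumℤ-ytilde : ∀ {L} → All (λ e → proj₂ e ≤ 1) L → + Σm L ℤ.≤ sumℤ (map ytilde L)
+Σm≤sumℤ-ytilde []                          = ℤ.+≤+ z≤n
+Σm≤sumℤ-ytilde {(m , δ) ∷ _} (δ≤1 ∷ δs≤1) = ℤP.+-mono-≤ (+m≤ytilde m δ δ≤1) (+Σm≤sumℤ-ytilde δs≤1)

m≤n+o⇒+m-+o≤+n : ∀ {m n o} → m ≤ n + o → + m ℤ.- + o ℤ.≤ + n
m≤n+o⇒+m-+o≤+n {m} {n} {o} m≤n+o = begin
  + m ℤ.- + o    ≡⟨ ℤP.[+m]-[+n]≡m⊖n m o ⟩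
  m ⊖ o          ≤⟨ ℤP.⊖-monoˡ-≤ o m≤n+o ⟩
  (n + o) ⊖ o    ≡⟨ ℤP.≤-⊖ (m≤n+m o n) ⟩
  + (n + o ∸ o)  ≡⟨ cong +_ (m+n∸n≡m n o) ⟩
  + n            ∎
  where open ℤP.≤-Reasoning

ztilde-bounds : ∀ {a b} x L → All (λ e → proj₂ e ≤ 1) L → a ≤ Σm L + b →
                (+ a ℤ.- + b ℤ.≤ ztilde (x ∷ L) (length (x ∷ L))) × (∀ i → + 0 ℤ.≤ ztilde (x ∷ L) i)
ztilde-bounds x L δs≤1 a≤Σm+b =
  ℤP.≤-trans (m≤n+o⇒+m-+o≤+n a≤Σm+b) (ℤP.≤-trans (+Σm≤sumℤ-ytilde δs≤1) (ℤP.≤-reflexive whole)) ,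
  λ i → ℤP.≤-trans (ℤ.+≤+ z≤n) (+Σm≤sumℤ-ytilde (All.take⁺ (i ∸ 1) δs≤1))
  where whole : sumℤ (map ytilde L) ≡ ztilde (x ∷ L) (length (x ∷ L))
        whole = cong (sumℤ ∘ map ytilde) (sym (take-all (length L) L ≤-refl))

mainTheorem15 : (n : ℕ) (T : Graph n) → IsForest T → 3 ≤ n →
    (∀ v → 1 ≤ deg T v) →
    Σ[ L ∈ List (ℕ × ℕ) ] (IsDeltaSequence T L ×
      ((+ ∣ PT T ∣ ℤ.- + ∣ N T (PT T) ∣) ℤ.≤ ztilde L (length L)) ×
      (∀ i → 2 ≤ i → i ≤ length L → + 0 ℤ.≤ ztilde L i))
mainTheorem15 (suc n) T forest _ noIsolated
  with Construction.goodDeltaSeq T forest ⊤ (⊂-wellFounded ⊤) (zero , ∈⊤)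
... | record { entries = (m , δ) ∷ L ; valid = valid ; δ≤1 = _ ∷ δs≤1 ; bound = bound }
  = let zₛ-bound , zᵢ-nonneg = ztilde-bounds (m , δ) L δs≤1 tail-bound
    in (m , δ) ∷ L , valid , zₛ-bound , λ i _ _ → zᵢ-nonneg i
  where
  m≡0 : m ≡ 0
  m≡0 = trans (deltaSeq-head T valid (¬IsEmptyForm⊤ T noIsolated zero)) (∣isoSet⊤∣≡0 T noIsolated)
  tail-bound : ∣ PT T ∣ ≤ Σm L + ∣ N T (PT T) ∣
  tail-bound = begin
    ∣ PT T ∣                      ≡⟨ cong ∣_∣ (∩-identityˡ (PT T)) ⟨
    ∣ ⊤ ∩ PT T ∣                  ≤⟨ bound ⟩
    m + Σm L + ∣ ⊤ ∩ N T (PT T) ∣ ≡⟨ cong₂ (λ k p → k + Σm L + ∣ p ∣) m≡0 (∩-identityˡ (N T (PT T))) ⟩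
    Σm L + ∣ N T (PT T) ∣         ∎
    where open ≤-Reasoning
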